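{- Let $k$ and $n$ be integers with $2\le k\le n$, and let $q,r$ be the unique integers with $n-1=(k-1)q+r$ and $0\le r<k-1$. Then there exists a connected $k^*$-dense graph on $n$ vertices with exactly $q\binom{k}{2}+\binom{r}{2}+r(k-r)$ edges.
   Context: All graphs are finite and simple. For an edge $uv$ of a graph $G$, the edge multiplicity is $m_G(uv)=|N_G(u)\cap N_G(v)|$. For an integer $k\ge 2$, a graph $G$ is called $k$-dense if $G$ has no isolated vertices and every edge $uv$ of $G$ satisfies $m_G(uv)\ge k-2$. A graph is $k^*$-dense if it is $k$-dense but not $(k+1)$-dense. Here $\binom{r}{2}=0$ for $r<2$. -}

module Defs where

open import Data.Nat using (ℕ; zero; suc; _+_; _*_; _∸_; _≤_; _<_)
open import Data.Nat.Combinatorics using (_C_)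
open import Data.Bool using (Bool; true; false; _∧_)
open import Data.Fin using (Fin; _<?_)
open import Data.Fin as F using ()
open import Data.List using (List; []; _∷_; length; filter; allFin; concatMap)
open import Data.Product using (Σ; ∃; _×_; _,_)
open import Relation.Binary.PropositionalEquality using (_≡_; _≢_)
open import Relation.Nullary using (¬_)
open import Relation.Nullary.Decidable using (does)

record Graph (n : ℕ) : Set where
  field
    adj   : Fin n → Fin n → Bool
    sym   : ∀ u v → adj u v ≡ adj v u
    irrefl : ∀ v → adj v v ≡ false
open Graph public

Adj : ∀ {n} → Graph n → Fin n → Fin n → Set
Adj G u v = adj G u v ≡ true

edgeCount : ∀ {n} → Graph n → ℕ
edgeCount {n} G =
  length (filter (λ p → Data.Fin._<?_ (Data.Product.proj₁ p) (Data.Product.proj₂ p))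
           (filter (λ p → adj G (Data.Product.proj₁ p) (Data.Product.proj₂ p) Data.Bool.≟ true)
              (concatMap (λ u → Data.List.map (λ v → (u , v)) (allFin n)) (allFin n))))

multiplicity : ∀ {n} → Graph n → Fin n → Fin n → ℕ
multiplicity {n} G u v =
  length (filter (λ w → (adj G u w ∧ adj G v w) Data.Bool.≟ true) (allFin n))

NoIsolated : ∀ {n} → Graph n → Set
NoIsolated {n} G = ∀ (v : Fin n) → ∃ λ u → Adj G v u

Dense : ℕ → ∀ {n} → Graph n → Set
Dense k G = NoIsolated G × (∀ u v → Adj G u v → k ∸ 2 ≤ multiplicity G u v)

DenseStar : ℕ → ∀ {n} → Graph n → Set
DenseStar k G = Dense k G × ¬ Dense (suc k) G

data Walk {n} (G : Graph n) : Fin n → Fin n → Set where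
  here : ∀ {v} → Walk G v v
  step : ∀ {u v w} → Adj G u v → Walk G v w → Walk G u w

Connected : ∀ {n} → Graph n → Set
Connected {n} G = ∀ (u v : Fin n) → Walk G u v

module Submission where

-- The graph is a chain of q copies of K_k, consecutive copies sharing one vertex,
-- followed by r further vertices, each joined to k - r vertices of the last copy
-- and to each other.  It is built one vertex at a time: a new vertex is always
-- placed at index 0 and joined to an "active" clique formed by the first c
-- vertices, which it then joins.  A Stage (k, m, c, d, E) records the invariants
-- of a partial construction on m vertices with E edges, where d = k - c vertices
-- are still to join the active clique: every edge has multiplicity at least k - 2
-- once the edges inside the active clique are credited d extra common neighbours.
-- Adding a vertex (grow) preserves this, and when d = 0 the clique can be shrunk
-- to a smaller prefix (restart).  At the end (d = 0) the invariant says exactly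
-- that the graph is k-dense, and the last edge added has multiplicity k - 2.

open import Defs hiding (sym)
open import Data.Nat using (ℕ; zero; suc; _+_; _*_; _∸_; _≤_; _<_; z≤n; s≤s; _<ᵇ_)
open import Data.Nat.Properties hiding (_≟_)
open import Data.Nat.Combinatorics using (_C_; nCk+nC[k+1]≡[n+1]C[k+1]; nC1≡n)
open import Data.Nat.Tactic.RingSolver using (solve-∀)
open import Data.Bool using (Bool; true; false; _∧_)
open import Data.Bool.Properties using (∧-comm; ∧-identityʳ; ∧-zeroʳ)
open import Data.Fin using (Fin; toℕ) renaming (zero to fz; suc to fs)
open import Data.Fin.Properties using (_≟_)
open import Data.List using (List; []; _∷_; length; filter; allFin; concatMap; tabulate; map; _++_)
open import Data.Product using (Σ; ∃; ∃₂; _×_; _,_; proj₁; proj₂)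
open import Data.Empty using (⊥-elim)
open import Relation.Binary.PropositionalEquality
open import Relation.Nullary using (¬_; yes; no; does)
open import Relation.Unary using (Pred; Decidable)
open import Function using (_∘_; id)
open import Algebra.Properties.CommutativeMonoid.Sum +-0-commutativeMonoid
  using (sum-syntax; sum-cong-≗; ∑-distrib-+; sum-replicate-zero)

⟦_⟧ : Bool → ℕ
⟦ true ⟧  = 1
⟦ false ⟧ = 0

countᵇ : {A : Set} → (A → Bool) → List A → ℕ
countᵇ f []       = 0
countᵇ f (x ∷ xs) = ⟦ f x ⟧ + countᵇ f xs

module Counting {A : Set} where

  length-filter : ∀ {p} {P : Pred A p} (P? : Decidable P) (xs : List A) →
    length (filter P? xs) ≡ countᵇ (does ∘ P?) xs
  length-filter P? []       = refl
  length-filter P? (x ∷ xs) with does (P? x)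
  ... | false = length-filter P? xs
  ... | true  = cong suc (length-filter P? xs)

  count-filter : ∀ {p} {P : Pred A p} (P? : Decidable P) (g : A → Bool) (xs : List A) →
    countᵇ g (filter P? xs) ≡ countᵇ (λ x → does (P? x) ∧ g x) xs
  count-filter P? g []       = refl
  count-filter P? g (x ∷ xs) with does (P? x)
  ... | false = count-filter P? g xs
  ... | true  = cong (⟦ g x ⟧ +_) (count-filter P? g xs)

  count-++ : (f : A → Bool) (xs ys : List A) → countᵇ f (xs ++ ys) ≡ countᵇ f xs + countᵇ f ys
  count-++ f []       ys = refl
  count-++ f (x ∷ xs) ys = trans (cong (⟦ f x ⟧ +_) (count-++ f xs ys)) (sym (+-assoc ⟦ f x ⟧ _ _))

  count-map : {B : Set} (f : B → Bool) (h : A → B) (xs : List A) → countᵇ f (map h xs) ≡ countᵇ (f ∘ h) xs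
  count-map f h []       = refl
  count-map f h (x ∷ xs) = cong (⟦ f (h x) ⟧ +_) (count-map f h xs)

  count-tabulate : ∀ m (f : A → Bool) (g : Fin m → A) → countᵇ f (tabulate g) ≡ ∑[ i < m ] ⟦ f (g i) ⟧
  count-tabulate zero    f g = refl
  count-tabulate (suc m) f g = cong (⟦ f (g fz) ⟧ +_) (count-tabulate m f (g ∘ fs))

  count-concatMap : {B : Set} (m : ℕ) (f : A → Bool) (h : B → List A) (g : Fin m → B) →
    countᵇ f (concatMap h (tabulate g)) ≡ ∑[ i < m ] countᵇ f (h (g i))
  count-concatMap zero    f h g = refl
  count-concatMap (suc m) f h g =
    trans (count-++ f (h (g fz)) _) (cong (countᵇ f (h (g fz)) +_) (count-concatMap m f h (g ∘ fs)))

open Counting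

does-≟true : ∀ b → does (b Data.Bool.≟ true) ≡ b
does-≟true true  = refl
does-≟true false = refl

common : ∀ {m} → Graph m → Fin m → Fin m → ℕ
common {m} G u v = ∑[ w < m ] ⟦ adj G u w ∧ adj G v w ⟧

multiplicity≡common : ∀ {m} (G : Graph m) u v → multiplicity G u v ≡ common G u v
multiplicity≡common {m} G u v = begin
  multiplicity G u v                                             ≡⟨ length-filter _ (allFin m) ⟩
  countᵇ (λ w → does ((adj G u w ∧ adj G v w) Data.Bool.≟ true)) (allFin m) ≡⟨ count-tabulate m _ id ⟩
  ∑[ w < m ] ⟦ does ((adj G u w ∧ adj G v w) Data.Bool.≟ true) ⟧ ≡⟨ sum-cong-≗ (cong ⟦_⟧ ∘ λ w → does-≟true (adj G u w ∧ adj G v w)) ⟩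
  common G u v                                                   ∎
  where open ≡-Reasoning

common-sym : ∀ {m} (G : Graph m) u v → common G u v ≡ common G v u
common-sym G u v = sum-cong-≗ (λ w → cong ⟦_⟧ (∧-comm (adj G u w) (adj G v w)))

edgeSum : ∀ {m} → Graph m → ℕ
edgeSum {m} G = ∑[ u < m ] ∑[ v < m ] ⟦ adj G u v ∧ (toℕ u <ᵇ toℕ v) ⟧

edgeCount≡edgeSum : ∀ {m} (G : Graph m) → edgeCount G ≡ edgeSum G
edgeCount≡edgeSum {m} G = begin
  edgeCount G                                          ≡⟨ length-filter less (filter adjacent pairs) ⟩
  countᵇ (does ∘ less) (filter adjacent pairs)         ≡⟨ count-filter adjacent (does ∘ less) pairs ⟩
  countᵇ test pairs                                    ≡⟨ count-concatMap m test row id ⟩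
  ∑[ u < m ] countᵇ test (row u)                       ≡⟨ sum-cong-≗ rowSum ⟩
  edgeSum G                                            ∎
  where
  open ≡-Reasoning
  row : Fin m → List (Fin m × Fin m)
  row u = map (λ v → (u , v)) (allFin m)
  pairs : List (Fin m × Fin m)
  pairs = concatMap row (allFin m)
  less : Decidable {A = Fin m × Fin m} (λ p → proj₁ p Data.Fin.< proj₂ p)
  less p = proj₁ p Data.Fin.<? proj₂ p
  adjacent : Decidable {A = Fin m × Fin m} (λ p → adj G (proj₁ p) (proj₂ p) ≡ true)
  adjacent p = adj G (proj₁ p) (proj₂ p) Data.Bool.≟ true
  test : Fin m × Fin m → Bool
  test p = does (adjacent p) ∧ does (less p)
  rowSum : ∀ u → countᵇ test (row u) ≡ ∑[ v < m ] ⟦ adj G u v ∧ (toℕ u <ᵇ toℕ v) ⟧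
  rowSum u = trans (count-map test _ (allFin m)) (trans (count-tabulate m _ id)
    (sum-cong-≗ λ v → cong (λ b → ⟦ b ∧ (toℕ u <ᵇ toℕ v) ⟧) (does-≟true (adj G u v))))

module _ {m : ℕ} (G : Graph m) (N : Fin m → Bool) where

  private
    adjExt : Fin (suc m) → Fin (suc m) → Bool
    adjExt fz     fz     = false
    adjExt fz     (fs v) = N v
    adjExt (fs u) fz     = N u
    adjExt (fs u) (fs v) = adj G u v

    symExt : ∀ u v → adjExt u v ≡ adjExt v u
    symExt fz     fz     = refl
    symExt fz     (fs v) = refl
    symExt (fs u) fz     = refl
    symExt (fs u) (fs v) = Graph.sym G u v

    irreflExt : ∀ v → adjExt v v ≡ false
    irreflExt fz     = refl
    irreflExt (fs v) = irrefl G v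

  extend : Graph (suc m)
  extend = record { adj = adjExt ; sym = symExt ; irrefl = irreflExt }

  edgeSum-extend : edgeSum extend ≡ ∑[ v < m ] ⟦ N v ⟧ + edgeSum G
  edgeSum-extend = cong₂ _+_
    (sum-cong-≗ λ v → cong ⟦_⟧ (∧-identityʳ (N v)))
    (sum-cong-≗ λ u → cong (λ b → ⟦ b ⟧ + ∑[ v < m ] ⟦ adj G u v ∧ (toℕ u <ᵇ toℕ v) ⟧) (∧-zeroʳ (N u)))

  private
    liftWalk : ∀ {a b} → Walk G a b → Walk extend (fs a) (fs b)
    liftWalk here       = here
    liftWalk (step e w) = step e (liftWalk w)

    walkToNew : ∀ {a} w₀ → N w₀ ≡ true → Walk extend a (fs w₀) → Walk extend a fz
    walkToNew w₀ e here       = step e here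
    walkToNew w₀ e (step x w) = step x (walkToNew w₀ e w)

  connected-extend : Connected G → ∀ w₀ → N w₀ ≡ true → Connected extend
  connected-extend conn w₀ e fz     fz     = here
  connected-extend conn w₀ e fz     (fs v) = step e (liftWalk (conn w₀ v))
  connected-extend conn w₀ e (fs u) fz     = walkToNew w₀ e (liftWalk (conn u w₀))
  connected-extend conn w₀ e (fs u) (fs v) = liftWalk (conn u v)

inPrefix : ∀ {m} → ℕ → Fin m → Bool
inPrefix c w = toℕ w <ᵇ c

prefix-size : ∀ m c → c ≤ m → ∑[ w < m ] ⟦ inPrefix c w ⟧ ≡ c
prefix-size m       zero    _         = sum-replicate-zero m
prefix-size (suc m) (suc c) (s≤s c≤m) = cong suc (prefix-size m c c≤m)

prefix-mono : ∀ a c c' → (a <ᵇ c') ≡ true → c' ≤ c → (a <ᵇ c) ≡ true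
prefix-mono zero    (suc c) (suc c') _ _         = refl
prefix-mono (suc a) (suc c) (suc c') e (s≤s c'≤c) = prefix-mono a c c' e c'≤c

delta-sum : ∀ m (v : Fin m) → ∑[ w < m ] ⟦ does (w ≟ v) ⟧ ≡ 1
delta-sum (suc m) fz     = cong suc (sum-replicate-zero m)
delta-sum (suc m) (fs v) = delta-sum m v

PrefixClique : ∀ {m} → Graph m → ℕ → Set
PrefixClique G c = ∀ u v → u ≢ v → inPrefix c u ≡ true → inPrefix c v ≡ true → Adj G u v

prefixClique-mono : ∀ {m} (G : Graph m) {c c'} → c' ≤ c → PrefixClique G c → PrefixClique G c'
prefixClique-mono G c'≤c cl u v u≢v cu cv =
  cl u v u≢v (prefix-mono _ _ _ cu c'≤c) (prefix-mono _ _ _ cv c'≤c)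

prefix-degree : ∀ {m} (G : Graph m) c → PrefixClique G c → c ≤ m → ∀ v → inPrefix c v ≡ true →
  suc (∑[ w < m ] ⟦ inPrefix c w ∧ adj G v w ⟧) ≡ c
prefix-degree {m} G c cl c≤m v cv = begin
  suc (∑[ w < m ] nbr w)                                  ≡⟨ +-comm 1 _ ⟩
  ∑[ w < m ] nbr w + 1                                    ≡⟨ cong (∑[ w < m ] nbr w +_) (delta-sum m v) ⟨
  ∑[ w < m ] nbr w + ∑[ w < m ] ⟦ does (w ≟ v) ⟧          ≡⟨ ∑-distrib-+ nbr (λ w → ⟦ does (w ≟ v) ⟧) ⟨
  ∑[ w < m ] (nbr w + ⟦ does (w ≟ v) ⟧)                   ≡⟨ sum-cong-≗ pointwise ⟩
  ∑[ w < m ] ⟦ inPrefix c w ⟧                             ≡⟨ prefix-size m c c≤m ⟩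
  c                                                       ∎
  where
  open ≡-Reasoning
  nbr : Fin m → ℕ
  nbr w = ⟦ inPrefix c w ∧ adj G v w ⟧
  pointwise : ∀ w → nbr w + ⟦ does (w ≟ v) ⟧ ≡ ⟦ inPrefix c w ⟧
  pointwise w with w ≟ v
  ... | yes refl rewrite cv | irrefl G w = refl
  ... | no w≢v with inPrefix c w in cw
  ...   | false = refl
  ...   | true rewrite cl v w (w≢v ∘ sym) cv cw = refl

extend-prefixClique : ∀ {m} (G : Graph m) c → PrefixClique G c → PrefixClique (extend G (inPrefix c)) (suc c)
extend-prefixClique G c cl fz     fz     u≢v _  _  = ⊥-elim (u≢v refl)
extend-prefixClique G c cl fz     (fs v) _   _  cv = cv
extend-prefixClique G c cl (fs u) fz     _   cu _  = cu
extend-prefixClique G c cl (fs u) (fs v) u≢v cu cv = cl u v (u≢v ∘ cong fs) cu cv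

-- The density of the edge uv once edges of the active clique (the first c
-- vertices) are credited the d common neighbours still to come.
PendingDense : ∀ {m} → ℕ → Graph m → ℕ → ℕ → Fin m → Fin m → Set
PendingDense k G c d u v = k ∸ 2 ≤ common G u v + ⟦ inPrefix c u ∧ inPrefix c v ⟧ * d

pendingDense-sym : ∀ {m k c d} (G : Graph m) u v → PendingDense k G c d u v → PendingDense k G c d v u
pendingDense-sym {c = c} {d} G u v p = ≤-trans p (≤-reflexive (cong₂ _+_ (common-sym G u v)
  (cong (λ b → ⟦ b ⟧ * d) (∧-comm (inPrefix c u) (inPrefix c v)))))

record Stage (k m c d E : ℕ) : Set where
  field
    graph        : Graph m
    active≥1     : 1 ≤ c
    active≤m     : c ≤ m
    active+d≡k   : c + d ≡ k
    activeClique : PrefixClique graph c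
    pendingDense : ∀ u v → Adj graph u v → PendingDense k graph c d u v
    connected    : Connected graph
    edges        : edgeSum graph ≡ E
    tightEdge    : d ≡ 0 → ∃₂ λ u v → Adj graph u v × common graph u v ≡ k ∸ 2

open Stage

recast : ∀ {k m c d E m' c' E'} → m ≡ m' → c ≡ c' → E ≡ E' → Stage k m c d E → Stage k m' c' d E'
recast refl refl refl s = s

-- The multiplicity count behind a new edge: with k = c + (1 + d) and c = 1 + X,
-- k - 2 = X + d.
new-edge-arith : ∀ c d X → suc X ≡ c → (c + suc d) ∸ 2 ≡ X + d
new-edge-arith _ d X refl rewrite +-suc X d = refl

-- Credits of an old edge: the new vertex is a common neighbour of both ends
-- exactly when the edge lies in the active clique.
old-edge-arith : ∀ b x d → x + b * suc d ≡ b + x + b * d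
old-edge-arith b x d rewrite *-suc b d = trans (sym (+-assoc x b (b * d))) (cong (_+ b * d) (+-comm x b))

grow : ∀ {k m c d E} → Stage k m c (suc d) E → Stage k (suc m) (suc c) d (c + E)
grow {k} {m} {c} {d} {E} s = record
  { graph        = G'
  ; active≥1     = s≤s z≤n
  ; active≤m     = s≤s (active≤m s)
  ; active+d≡k   = trans (sym (+-suc c d)) (active+d≡k s)
  ; activeClique = extend-prefixClique G c (activeClique s)
  ; pendingDense = dense
  ; connected    = connected-extend G (inPrefix c) (connected s) (proj₁ anchor) (proj₂ anchor)
  ; edges        = trans (edgeSum-extend G (inPrefix c)) (cong₂ _+_ (prefix-size m c (active≤m s)) (edges s))
  ; tightEdge    = λ { refl → fz , fs (proj₁ anchor) , proj₂ anchor ,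
      trans (sym (+-identityʳ _)) (new-common (proj₁ anchor) (proj₂ anchor)) }
  }
  where
  G : Graph m
  G = graph s
  G' : Graph (suc m)
  G' = extend G (inPrefix c)
  anchor : ∃ λ w → inPrefix c w ≡ true
  anchor with active≥1 s | active≤m s
  ... | s≤s z≤n | s≤s _ = fz , refl
  -- the common neighbours of a new edge 0v are the c - 1 other active vertices
  new-common : ∀ v → inPrefix c v ≡ true → common G' fz (fs v) + d ≡ k ∸ 2
  new-common v cv = sym (trans (cong (_∸ 2) (sym (active+d≡k s)))
    (new-edge-arith c d _ (prefix-degree G c (activeClique s) (active≤m s) v cv)))
  dense : ∀ u v → Adj G' u v → PendingDense k G' (suc c) d u v
  dense fz     fz     ()
  dense fz     (fs v) cv rewrite cv = ≤-reflexive (trans (sym (new-common v cv))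
    (cong (common G' fz (fs v) +_) (sym (+-identityʳ d))))
  dense (fs u) fz     cu = pendingDense-sym {k = k} {suc c} {d} G' fz (fs u) (dense fz (fs u) cu)
  -- an old edge gains the new vertex as common neighbour iff it is active
  dense (fs u) (fs v) e  = ≤-trans (pendingDense s u v e)
    (≤-reflexive (old-edge-arith ⟦ inPrefix c u ∧ inPrefix c v ⟧ (common G u v) d))

-- Pascal's rule for pairs: the pairs from j + 1 elements are the j pairs
-- containing the last one and the pairs from the first j.
choose2-suc : ∀ j → suc j C 2 ≡ j + j C 2
choose2-suc j = trans (sym (nCk+nC[k+1]≡[n+1]C[k+1] j 1)) (cong (_+ j C 2) (nC1≡n j))

growMany : ∀ {k} j {m c E} → Stage k m c j E → Stage k (j + m) (j + c) 0 (j C 2 + j * c + E)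
growMany zero    s = s
growMany (suc j) {m} {c} {E} s =
  recast (+-suc j m) (+-suc j c) edges-eq (growMany j (grow s))
  where
  ring : ∀ b j c E → b + (j + j * c) + (c + E) ≡ j + b + (c + j * c) + E
  ring = solve-∀
  edges-eq : j C 2 + j * suc c + (c + E) ≡ suc j C 2 + suc j * c + E
  edges-eq rewrite choose2-suc j | *-suc j c = ring (j C 2) j c E

restart : ∀ {k m c E} c' d' → 1 ≤ c' → c' + d' ≡ k → Stage k m c 0 E → Stage k m c' d' E
restart {k} {m} {c} c' d' c'≥1 c'+d'≡k s = record
  { graph        = graph s
  ; active≥1     = c'≥1
  ; active≤m     = ≤-trans c'≤c (active≤m s)
  ; active+d≡k   = c'+d'≡k
  ; activeClique = prefixClique-mono (graph s) c'≤c (activeClique s)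
  ; pendingDense = λ u v e → ≤-trans (pendingDense s u v e) (+-monoʳ-≤ (common (graph s) u v)
      (≤-trans (≤-reflexive (*-zeroʳ ⟦ inPrefix c u ∧ inPrefix c v ⟧)) z≤n))
  ; connected    = connected s
  ; edges        = edges s
  ; tightEdge    = λ _ → tightEdge s refl
  }
  where
  c'≤c : c' ≤ c
  c'≤c = ≤-trans (m≤m+n c' d') (≤-reflexive (trans c'+d'≡k (trans (sym (active+d≡k s)) (+-identityʳ c))))

single : Graph 1
single = record { adj = λ _ _ → false ; sym = λ _ _ → refl ; irrefl = λ _ → refl }

start : ∀ k₂ → Stage (suc (suc k₂)) 1 1 (suc k₂) 0
start k₂ = record
  { graph = single ; active≥1 = s≤s z≤n ; active≤m = s≤s z≤n ; active+d≡k = refl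
  ; activeClique = λ { fz fz 0≢0 _ _ → ⊥-elim (0≢0 refl) } ; pendingDense = λ _ _ ()
  ; connected = λ { fz fz → here } ; edges = refl ; tightEdge = λ () }

completeClique : ∀ {K m E} → Stage (suc K) m 1 K E → Stage (suc K) (K + m) (suc K) 0 (suc K C 2 + E)
completeClique {K} {m} {E} s = recast refl (+-comm K 1) edges-eq (growMany K s)
  where
  edges-eq : K C 2 + K * 1 + E ≡ suc K C 2 + E
  edges-eq = cong (_+ E) (trans (+-comm (K C 2) (K * 1))
    (trans (cong (_+ K C 2) (*-identityʳ K)) (sym (choose2-suc K))))

-- q = p + 1 copies of K_k, consecutive ones sharing a vertex.
cliqueChain : ∀ k₂ p → let K = suc k₂ in Stage (suc K) (suc (suc p * K)) (suc K) 0 (suc p * (suc K C 2))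
cliqueChain k₂ zero    =
  recast (trans (+-comm (suc k₂) 1) (cong suc (sym (+-identityʳ _)))) refl refl (completeClique (start k₂))
cliqueChain k₂ (suc p) = recast (+-suc (suc k₂) _) refl refl
  (completeClique (restart 1 (suc k₂) (s≤s z≤n) refl (cliqueChain k₂ p)))

walk-firstEdge : ∀ {n} {G : Graph n} {u v} → Walk G u v → u ≢ v → ∃ λ w → Adj G u w
walk-firstEdge here       u≢v = ⊥-elim (u≢v refl)
walk-firstEdge (step e _) _   = _ , e

noIsolated : ∀ {n} (G : Graph (suc (suc n))) → Connected G → NoIsolated G
noIsolated G conn fz     = walk-firstEdge (conn fz (fs fz)) (λ ())
noIsolated G conn (fs v) = walk-firstEdge (conn (fs v) fz) (λ ())

-- With d = 0 the invariant is k-density, and the tight edge rules out (k+1)-density.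
fromStage : ∀ k₂ {n c E} → let k = suc (suc k₂) in Stage k (suc (suc n)) c 0 E →
  ∃ λ (G : Graph (suc (suc n))) → Connected G × DenseStar k G × (edgeCount G ≡ E)
fromStage k₂ {n} {c} s =
  G , connected s , ((noIsolated G (connected s) , dense) , notDenser) , trans (edgeCount≡edgeSum G) (edges s)
  where
  G : Graph (suc (suc n))
  G = graph s
  dense : ∀ u v → Adj G u v → k₂ ≤ multiplicity G u v
  dense u v e = ≤-trans (pendingDense s u v e) (≤-reflexive
    (trans (cong (common G u v +_) (*-zeroʳ ⟦ inPrefix c u ∧ inPrefix c v ⟧))
      (trans (+-identityʳ _) (sym (multiplicity≡common G u v)))))
  notDenser : ¬ Dense (suc (suc (suc k₂))) G
  notDenser (_ , denser) with tightEdge s refl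
  ... | u , v , e , tight = <-irrefl refl (≤-trans (denser u v e)
    (≤-reflexive (trans (multiplicity≡common G u v) tight)))

proposition5p2 : (k n q r : ℕ) → 2 ≤ k → k ≤ n →
    n ∸ 1 ≡ (k ∸ 1) * q + r → r < k ∸ 1 →
    Σ (Graph n) (λ G → Connected G × DenseStar k G ×
    (edgeCount G ≡ q * (k C 2) + (r C 2) + r * (k ∸ r)))
proposition5p2 (suc (suc k₂)) (suc (suc n₂)) zero r _ (s≤s (s≤s k₂≤n₂)) n∸1≡ r<K =
  -- q = 0 would give n - 1 = r < k - 1
  ⊥-elim (<-irrefl refl (≤-trans (s≤s (s≤s k₂≤n₂)) (≤-trans (≤-reflexive (cong suc n∸1≡r)) r<K)))
  where
  n∸1≡r : suc n₂ ≡ r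
  n∸1≡r = trans n∸1≡ (cong (_+ r) (*-zeroʳ (suc k₂)))
proposition5p2 (suc (suc k₂)) (suc (suc n₂)) (suc p) r _ _ n∸1≡ r<K =
  fromStage k₂ (recast vertices refl edges-eq
    (growMany r (restart (k ∸ r) r (m<n⇒0<n∸m r<k) (m∸n+n≡m (<⇒≤ r<k)) (cliqueChain k₂ p))))
  where
  k : ℕ
  k = suc (suc k₂)
  r<k : r < k
  r<k = m<n⇒m<1+n r<K
  ring-vertices : ∀ r p K → r + suc (K + p * K) ≡ suc (K * suc p + r)
  ring-vertices = solve-∀
  vertices : r + suc (suc p * suc k₂) ≡ suc (suc n₂)
  vertices = trans (ring-vertices r p (suc k₂)) (cong suc (sym n∸1≡))
  ring-edges : ∀ x y z → x + y + z ≡ z + x + y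
  ring-edges = solve-∀
  edges-eq : r C 2 + r * (k ∸ r) + suc p * (k C 2) ≡ suc p * (k C 2) + r C 2 + r * (k ∸ r)
  edges-eq = ring-edges (r C 2) (r * (k ∸ r)) (suc p * (k C 2))
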